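{- Let $r\ge 1$ be an integer and let $(F^{(r)}_k)_{k\in\mathbb{Z}}$ be the $r$-th generation hyperfibonacci sequence, extended to all integer indices as described in the context. For an integer $n$, let $A_{r,n}$ be the $(r+2)\times(r+2)$ matrix with entries $(A_{r,n})_{i,j}=F^{(r)}_{n+i+j-2}$, $1\le i,j\le r+2$. Then for every $n\in\mathbb{Z}$, $$\det(A_{r,n})=(-1)^{\,n+\lfloor (r+3)/2\rfloor}.$$
   Context: Let $(F_k)_{k\ge0}$ be the Fibonacci numbers, $F_0=0$, $F_1=1$, $F_{k+2}=F_{k+1}+F_k$. The hyperfibonacci numbers are defined for $k\ge 0$ by $F^{(0)}_k=F_k$ and, for $r\ge1$, $F^{(r)}_k=\sum_{j=0}^{k}F^{(r-1)}_j$ (so $F^{(r)}_0=0$, $F^{(r)}_1=1$). For fixed $r\ge1$ these satisfy, for $k\ge0$, $F^{(r)}_{k+2}=F^{(r)}_{k+1}+F^{(r)}_k+\binom{k+r}{r-1}$; the sequence is extended to negative indices as the unique two-sided sequence satisfying this recurrence for all $k\in\mathbb{Z}$, where $\binom{k+r}{r-1}$ is interpreted as the polynomial $\frac{(k+r)(k+r-1)\cdots(k+2)}{(r-1)!}$ in $k$ (equal to $1$ when $r=1$). (In particular $F^{(r)}_{k}=0$ for $-r\le k\le 0$.) -}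

module Defs where

open import Data.Nat as ℕ using (ℕ; zero; suc; _!)
open import Data.Nat.Properties using (_!≢0)
open import Data.Integer as ℤ using (ℤ; +_; -_; _+_; _*_; _^_; ∣_∣; _/ℕ_)
open import Data.Fin using (Fin; zero; suc; toℕ; punchIn)

fib : ℕ → ℕ
fib zero = 0
fib (suc zero) = 1
fib (suc (suc k)) = fib (suc k) ℕ.+ fib k

hyperfib : ℕ → ℕ → ℕ
psum : ℕ → ℕ → ℕ
hyperfib zero k = fib k
hyperfib (suc r) k = psum r k
psum r zero = hyperfib r zero
psum r (suc k) = psum r k ℕ.+ hyperfib r (suc k)

fallingProd : ℤ → ℕ → ℤ
fallingProd x zero = + 1
fallingProd x (suc m) = x * fallingProd (x ℤ.- + 1) m

-- binom(k+r, r-1) for r ≥ 1, as the polynomial (k+r)(k+r-1)...(k+2)/(r-1)! in k ∈ ℤ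
-- (for r = 0 this is set to 0; it is never used with r = 0)
binomPoly : ℕ → ℤ → ℤ
binomPoly zero k = + 0
binomPoly (suc m) k = _/ℕ_ (fallingProd (k + + (suc m)) m) (m !) {{m !≢0}}

IsHyperfibZ : ℕ → (ℤ → ℤ) → Set
IsHyperfibZ r f =
  (∀ (k : ℤ) → f (k + + 2) ≡ f (k + + 1) + f k + binomPoly r k) ×
  (∀ (k : ℕ) → f (+ k) ≡ + hyperfib r k)
  where open import Relation.Binary.PropositionalEquality using (_≡_)
        open import Data.Product using (_×_)

sumFin : ∀ n → (Fin n → ℤ) → ℤ
sumFin zero f = + 0
sumFin (suc n) f = f zero + sumFin n (λ i → f (suc i))

det : ∀ n → (Fin n → Fin n → ℤ) → ℤ
det zero M = + 1
det (suc n) M =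
  sumFin (suc n) (λ j → ((- + 1) ^ toℕ j) * M zero j * det n (λ a b → M (suc a) (punchIn j b)))

negOnePow : ℤ → ℤ
negOnePow n = (- + 1) ^ ∣ n ∣

-- Hankel matrix A_{r,n} (0-indexed): entry (i,j) = f (n + i + j)
hankel : ∀ r → (ℤ → ℤ) → ℤ → Fin (r ℕ.+ 2) → Fin (r ℕ.+ 2) → ℤ
hankel r f n i j = f (n + + toℕ i + + toℕ j)

-- The extended sequence satisfies a linear recurrence of order r + 2 with characteristic polynomial
-- (X² − X − 1)(X − 1)ʳ: the inhomogeneous term binom(k + r, r − 1) is a polynomial of degree r − 1
-- in k, so r backward differences remove it. As the constant coefficient is (−1)ʳ⁺¹, the last column
-- of A_{r,n+1} is (−1)ʳ times the first column of A_{r,n} plus a combination of the columns the two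
-- matrices share; moving that column to the front costs another (−1)ʳ⁺¹, so det A_{r,n+1} = −det A_{r,n}.
-- At n = −r the matrix is anti-triangular, with F_{−r}, …, F₀ = 0 above the antidiagonal and F₁ = 1
-- on it, so its determinant is the sign (−1)^((r+2)(r+1)/2) of the order-reversing permutation.

module Submission where

open import Defs
open import Data.Nat using (ℕ; _≥_; _/_)
open import Data.Nat as ℕ using (zero; suc; z≤n; s≤s; _!)
import Data.Nat.Properties as ℕ
open import Data.Nat.Properties using (_!≢0)
open import Data.Nat.DivMod using (m/n≡1+[m∸n]/n)
open import Data.Nat.Divisibility using (>⇒∤)
open import Data.Integer using (ℤ; +_; -[1+_]; _+_; -_; _-_; _*_; _^_; ∣_∣; _/ℕ_; _%ℕ_)
import Data.Integer.Properties as ℤ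
open import Data.Integer.DivMod using (a≡a%ℕn+[a/ℕn]*n; n%ℕd<d)
open import Data.Integer.Divisibility.Signed
  using (_∣_; divides; ∣-refl; ∣⇒∣ᵤ; ∣m∣n⇒∣m+n; ∣m+n∣n⇒∣m; *-monoʳ-∣)
open import Data.Integer.Tactic.RingSolver using (solve-∀)
open import Data.Fin using (Fin; toℕ; punchIn)
open import Data.List using (List; []; _∷_; _++_; length; map)
open import Data.List.Properties using (length-map)
open import Data.Product using (∃; _,_; _×_; proj₁; proj₂)
open import Data.Sum using (inj₁; inj₂)
open import Data.Empty using (⊥-elim)
open import Relation.Binary using (tri<; tri≈; tri>)
open import Relation.Binary.PropositionalEquality
  using (_≡_; _≢_; refl; sym; trans; cong; cong₂; subst; module ≡-Reasoning)
open import Relation.Nullary using (yes; no)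

open ≡-Reasoning

sign : ℕ → ℤ
sign zero = + 1
sign (suc k) = - sign k

-1^≡sign : ∀ k → (- + 1) ^ k ≡ sign k
-1^≡sign zero = refl
-1^≡sign (suc k) = trans (ℤ.-1*i≡-i _) (cong -_ (-1^≡sign k))

sign-squared : ∀ k → sign k * sign k ≡ + 1
sign-squared zero = refl
sign-squared (suc k) = trans (neg*neg (sign k)) (sign-squared k)
  where
  neg*neg : ∀ a → - a * - a ≡ a * a
  neg*neg = solve-∀

∑ : ℕ → (ℕ → ℤ) → ℤ
∑ zero g = + 0
∑ (suc n) g = g 0 + ∑ n (λ j → g (suc j))

∑-cong : ∀ n {g h : ℕ → ℤ} → (∀ j → j ℕ.< n → g j ≡ h j) → ∑ n g ≡ ∑ n h
∑-cong zero _ = refl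
∑-cong (suc n) g≡h = cong₂ _+_ (g≡h 0 (s≤s z≤n)) (∑-cong n (λ j j<n → g≡h (suc j) (s≤s j<n)))

∑-neg : ∀ n g → ∑ n (λ j → - g j) ≡ - ∑ n g
∑-neg zero g = refl
∑-neg (suc n) g = trans (cong (λ u → - g 0 + u) (∑-neg n (λ j → g (suc j)))) (sym (ℤ.neg-distrib-+ (g 0) _))

∑-linear : ∀ n x y g h → ∑ n (λ j → x * g j + y * h j) ≡ x * ∑ n g + y * ∑ n h
∑-linear zero x y g h = zeros x y
  where
  zeros : ∀ x y → + 0 ≡ x * + 0 + y * + 0
  zeros = solve-∀
∑-linear (suc n) x y g h =
  trans (cong (λ u → x * g 0 + y * h 0 + u) (∑-linear n x y (λ j → g (suc j)) (λ j → h (suc j))))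
        (regroup x y (g 0) (h 0) _ _)
  where
  regroup : ∀ x y a b c d → (x * a + y * b) + (x * c + y * d) ≡ x * (a + c) + y * (b + d)
  regroup = solve-∀

∑-onlyLast : ∀ n g → (∀ j → j ℕ.< n → g j ≡ + 0) → ∑ (suc n) g ≡ g n
∑-onlyLast zero g _ = ℤ.+-identityʳ (g 0)
∑-onlyLast (suc n) g g≡0 =
  trans (cong₂ _+_ (g≡0 0 (s≤s z≤n)) (∑-onlyLast n (λ j → g (suc j)) (λ j j<n → g≡0 (suc j) (s≤s j<n))))
        (ℤ.+-identityˡ _)

-- swapSuc a is the transposition a ↔ a + 1.
swapSuc : ℕ → ℕ → ℕ
swapSuc zero zero = 1
swapSuc zero (suc zero) = 0
swapSuc zero (suc (suc j)) = suc (suc j)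
swapSuc (suc a) zero = zero
swapSuc (suc a) (suc j) = suc (swapSuc a j)

swapSuc-same : ∀ a → swapSuc a a ≡ suc a
swapSuc-same zero = refl
swapSuc-same (suc a) = cong suc (swapSuc-same a)

swapSuc-suc : ∀ a → swapSuc a (suc a) ≡ a
swapSuc-suc zero = refl
swapSuc-suc (suc a) = cong suc (swapSuc-suc a)

swapSuc-< : ∀ a j → j ℕ.< a → swapSuc a j ≡ j
swapSuc-< (suc a) zero _ = refl
swapSuc-< (suc a) (suc j) (s≤s j<a) = cong suc (swapSuc-< a j j<a)

swapSuc-> : ∀ a j → suc a ℕ.< j → swapSuc a j ≡ j
swapSuc-> zero (suc zero) (s≤s ())
swapSuc-> zero (suc (suc j)) _ = refl
swapSuc-> (suc a) (suc j) (s≤s a+1<j) = cong suc (swapSuc-> a j a+1<j)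

∑-swapSuc : ∀ n a g → suc a ℕ.< n → ∑ n (λ j → g (swapSuc a j)) ≡ ∑ n g
∑-swapSuc (suc (suc n)) zero g _ = swap (g 1) (g 0) _
  where
  swap : ∀ a b c → a + (b + c) ≡ b + (a + c)
  swap = solve-∀
∑-swapSuc (suc n) (suc a) g (s≤s a+1<n) = cong (λ u → g 0 + u) (∑-swapSuc n a (λ j → g (suc j)) a+1<n)

rotate : ℕ → ℕ → ℕ
rotate zero j = j
rotate (suc k) j = rotate k (swapSuc k j)

rotate-> : ∀ k j → k ℕ.< j → rotate k j ≡ j
rotate-> zero j _ = refl
rotate-> (suc k) j k+1<j = trans (cong (rotate k) (swapSuc-> k j k+1<j)) (rotate-> k j (ℕ.<-trans (ℕ.n<1+n k) k+1<j))

rotate-same : ∀ k → rotate k k ≡ 0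
rotate-same zero = refl
rotate-same (suc k) = trans (cong (rotate k) (swapSuc-suc k)) (rotate-same k)

rotate-< : ∀ k j → j ℕ.< k → rotate k j ≡ suc j
rotate-< (suc k) j (s≤s j≤k) with ℕ.m≤n⇒m<n∨m≡n j≤k
... | inj₁ j<k = trans (cong (rotate k) (swapSuc-< k j j<k)) (rotate-< k j j<k)
... | inj₂ refl = trans (cong (rotate j) (swapSuc-same j)) (rotate-> j (suc j) (ℕ.n<1+n j))

punchInℕ : ℕ → ℕ → ℕ
punchInℕ zero b = suc b
punchInℕ (suc j) zero = zero
punchInℕ (suc j) (suc b) = suc (punchInℕ j b)

punchInℕ≢ : ∀ j b → punchInℕ j b ≢ j
punchInℕ≢ (suc j) (suc b) eq = punchInℕ≢ j b (ℕ.suc-injective eq)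

punchInℕ-injective : ∀ j b c → punchInℕ j b ≡ punchInℕ j c → b ≡ c
punchInℕ-injective zero b c eq = ℕ.suc-injective eq
punchInℕ-injective (suc j) zero zero _ = refl
punchInℕ-injective (suc j) (suc b) (suc c) eq = cong suc (punchInℕ-injective j b c (ℕ.suc-injective eq))

punchInℕ-surjective : ∀ j k → j ≢ k → ∃ λ b → punchInℕ j b ≡ k
punchInℕ-surjective zero zero j≢k = ⊥-elim (j≢k refl)
punchInℕ-surjective zero (suc k) _ = k , refl
punchInℕ-surjective (suc j) zero _ = zero , refl
punchInℕ-surjective (suc j) (suc k) j≢k
  with b , eq ← punchInℕ-surjective j k (λ j≡k → j≢k (cong suc j≡k)) = suc b , cong suc eq

punchInℕ-< : ∀ j b n → j ℕ.≤ n → b ℕ.< n → punchInℕ j b ℕ.< suc n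
punchInℕ-< zero b n _ b<n = s≤s b<n
punchInℕ-< (suc j) zero (suc n) _ _ = s≤s z≤n
punchInℕ-< (suc j) (suc b) (suc n) (s≤s j≤n) (s≤s b<n) = s≤s (punchInℕ-< j b n j≤n b<n)

punchInℕ-<-cancel : ∀ j b n → j ℕ.≤ n → punchInℕ j b ℕ.< suc n → b ℕ.< n
punchInℕ-<-cancel zero b n _ (s≤s b<n) = b<n
punchInℕ-<-cancel (suc j) zero (suc n) _ _ = s≤s z≤n
punchInℕ-<-cancel (suc j) (suc b) (suc n) (s≤s j≤n) (s≤s lt) = s≤s (punchInℕ-<-cancel j b n j≤n lt)

punchInℕ-below : ∀ j b → b ℕ.< j → punchInℕ j b ≡ b
punchInℕ-below (suc j) zero _ = refl
punchInℕ-below (suc j) (suc b) (s≤s b<j) = cong suc (punchInℕ-below j b b<j)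

swapSuc-punchInℕ-left : ∀ j a b → j ℕ.≤ a → swapSuc (suc a) (punchInℕ j b) ≡ punchInℕ j (swapSuc a b)
swapSuc-punchInℕ-left zero a b _ = refl
swapSuc-punchInℕ-left (suc j) (suc a) zero _ = refl
swapSuc-punchInℕ-left (suc j) (suc a) (suc b) (s≤s j≤a) = cong suc (swapSuc-punchInℕ-left j a b j≤a)

swapSuc-punchInℕ-right : ∀ a j b → suc (suc a) ℕ.≤ j → swapSuc a (punchInℕ j b) ≡ punchInℕ j (swapSuc a b)
swapSuc-punchInℕ-right zero (suc zero) b (s≤s ())
swapSuc-punchInℕ-right zero (suc (suc j)) zero _ = refl
swapSuc-punchInℕ-right zero (suc (suc j)) (suc zero) _ = refl
swapSuc-punchInℕ-right zero (suc (suc j)) (suc (suc b)) _ = refl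
swapSuc-punchInℕ-right (suc a) (suc j) zero _ = refl
swapSuc-punchInℕ-right (suc a) (suc j) (suc b) (s≤s a+2≤j) = cong suc (swapSuc-punchInℕ-right a j b a+2≤j)

swapSuc-punchInℕ-same : ∀ a b → swapSuc a (punchInℕ a b) ≡ punchInℕ (suc a) b
swapSuc-punchInℕ-same zero zero = refl
swapSuc-punchInℕ-same zero (suc b) = refl
swapSuc-punchInℕ-same (suc a) zero = refl
swapSuc-punchInℕ-same (suc a) (suc b) = cong suc (swapSuc-punchInℕ-same a b)

swapSuc-punchInℕ-suc : ∀ a b → swapSuc a (punchInℕ (suc a) b) ≡ punchInℕ a b
swapSuc-punchInℕ-suc zero zero = refl
swapSuc-punchInℕ-suc zero (suc b) = refl
swapSuc-punchInℕ-suc (suc a) zero = refl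
swapSuc-punchInℕ-suc (suc a) (suc b) = cong suc (swapSuc-punchInℕ-suc a b)

toℕ-punchIn : ∀ {n} (j : Fin (suc n)) (b : Fin n) → toℕ (punchIn j b) ≡ punchInℕ (toℕ j) (toℕ b)
toℕ-punchIn Fin.zero b = refl
toℕ-punchIn {suc n} (Fin.suc j) Fin.zero = refl
toℕ-punchIn {suc n} (Fin.suc j) (Fin.suc b) = cong suc (toℕ-punchIn j b)

lincomb : List ℤ → (ℕ → ℤ) → ℕ → ℤ
lincomb [] v s = + 0
lincomb (a ∷ as) v s = a * v s + lincomb as v (suc s)

lincomb-cong : ∀ as (v w : ℕ → ℤ) s → (∀ l → l ℕ.< s ℕ.+ length as → v l ≡ w l) →
  lincomb as v s ≡ lincomb as w s
lincomb-cong [] v w s _ = refl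
lincomb-cong (a ∷ as) v w s v≡w =
  cong₂ (λ x y → a * x + y) (v≡w s (ℕ.m<m+n s (s≤s z≤n)))
        (lincomb-cong as v w (suc s) λ l l<s+1+|as| →
          v≡w l (subst (l ℕ.<_) (sym (ℕ.+-suc s (length as))) l<s+1+|as|))

lincomb-scale : ∀ as d v s → lincomb as (λ l → d * v l) s ≡ d * lincomb as v s
lincomb-scale [] d v s = sym (ℤ.*-zeroʳ d)
lincomb-scale (a ∷ as) d v s =
  trans (cong (λ y → a * (d * v s) + y) (lincomb-scale as d v (suc s))) (factor a d (v s) _)
  where
  factor : ∀ a d x y → a * (d * x) + d * y ≡ d * (a * x + y)
  factor = solve-∀

lincomb-neg : ∀ as v s → lincomb (map -_ as) v s ≡ - lincomb as v s
lincomb-neg [] v s = refl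
lincomb-neg (a ∷ as) v s = trans (cong (λ y → - a * v s + y) (lincomb-neg as v (suc s))) (negate a (v s) _)
  where
  negate : ∀ a x y → - a * x + - y ≡ - (a * x + y)
  negate = solve-∀

lincomb-snoc : ∀ as a v s → lincomb (as ++ a ∷ []) v s ≡ lincomb as v s + a * v (s ℕ.+ length as)
lincomb-snoc [] a v s = begin
  a * v s + + 0          ≡⟨ ℤ.+-identityʳ (a * v s) ⟩
  a * v s                ≡⟨ sym (ℤ.+-identityˡ _) ⟩
  + 0 + a * v s          ≡⟨ cong (λ l → + 0 + a * v l) (sym (ℕ.+-identityʳ s)) ⟩
  + 0 + a * v (s ℕ.+ 0)  ∎
lincomb-snoc (b ∷ as) a v s = begin
  b * v s + lincomb (as ++ a ∷ []) v (suc s)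
    ≡⟨ cong (λ y → b * v s + y) (lincomb-snoc as a v (suc s)) ⟩
  b * v s + (lincomb as v (suc s) + a * v (suc s ℕ.+ length as))
    ≡⟨ sym (ℤ.+-assoc (b * v s) _ _) ⟩
  b * v s + lincomb as v (suc s) + a * v (suc s ℕ.+ length as)
    ≡⟨ cong (λ l → b * v s + lincomb as v (suc s) + a * v l) (sym (ℕ.+-suc s (length as))) ⟩
  b * v s + lincomb as v (suc s) + a * v (s ℕ.+ suc (length as)) ∎

lincomb-shift : ∀ as v s → lincomb as (λ l → v (suc l)) s ≡ lincomb as v (suc s)
lincomb-shift [] v s = refl
lincomb-shift (a ∷ as) v s = cong (λ y → a * v (suc s) + y) (lincomb-shift as v (suc s))

-- Determinants

Matrix : Set
Matrix = ℕ → ℕ → ℤ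

_∘ᶜ_ : Matrix → (ℕ → ℕ) → Matrix
(M ∘ᶜ π) i j = M i (π j)

minor : ℕ → Matrix → Matrix
minor j M a b = M (suc a) (punchInℕ j b)

-- The Laplace expansion defining det, for ℕ-indexed arrays; detℕ n reads only the n × n corner.
detℕ : ℕ → Matrix → ℤ
laplaceTerm : ℕ → Matrix → ℕ → ℤ
detℕ zero M = + 1
detℕ (suc n) M = ∑ (suc n) (laplaceTerm n M)
laplaceTerm n M j = sign j * M 0 j * detℕ n (minor j M)

detℕ-cong : ∀ n {M N : Matrix} → (∀ i j → i ℕ.< n → j ℕ.< n → M i j ≡ N i j) →
  detℕ n M ≡ detℕ n N
detℕ-cong zero _ = refl
detℕ-cong (suc n) M≡N = ∑-cong (suc n) λ j j<n+1 →
  cong₂ _*_ (cong (sign j *_) (M≡N 0 j (s≤s z≤n) j<n+1))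
            (detℕ-cong n λ a b a<n b<n →
              M≡N (suc a) (punchInℕ j b) (s≤s a<n) (punchInℕ-< j b n (ℕ.≤-pred j<n+1) b<n))

private
  negate-right : ∀ s x d → s * x * (- d) ≡ - (s * x * d)
  negate-right = solve-∀
  negate-left : ∀ s x d → - s * x * d ≡ - (s * x * d)
  negate-left = solve-∀

laplaceTerm-fixed : ∀ n M π j → π j ≡ j → detℕ n (minor j (M ∘ᶜ π)) ≡ - detℕ n (minor j M) →
  laplaceTerm n (M ∘ᶜ π) j ≡ - laplaceTerm n M (π j)
laplaceTerm-fixed n M π j πj≡j minor≡- rewrite πj≡j =
  trans (cong (sign j * M 0 j *_) minor≡-) (negate-right (sign j) (M 0 j) _)

laplaceTerm-swapSuc : ∀ n a M j → suc a ℕ.< suc n → j ℕ.< suc n →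
  (∀ a M → suc a ℕ.< n → detℕ n (M ∘ᶜ swapSuc a) ≡ - detℕ n M) →
  laplaceTerm n (M ∘ᶜ swapSuc a) j ≡ - laplaceTerm n M (swapSuc a j)
laplaceTerm-swapSuc n a M j a+1<n+1 j<n+1 ih with ℕ.<-cmp j a
... | tri< j<a _ _ = laplaceTerm-fixed n M (swapSuc a) j (swapSuc-< a j j<a) (minor-left a j<a a+1<n+1)
  where
  minor-left : ∀ a → j ℕ.< a → suc a ℕ.< suc n →
    detℕ n (minor j (M ∘ᶜ swapSuc a)) ≡ - detℕ n (minor j M)
  minor-left (suc a) (s≤s j≤a) (s≤s a+1<n) =
    trans (detℕ-cong n λ x b _ _ → cong (M (suc x)) (swapSuc-punchInℕ-left j a b j≤a)) (ih a (minor j M) a+1<n)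
... | tri≈ _ refl _ rewrite swapSuc-same a = begin
  sign a * M 0 (suc a) * detℕ n (minor a (M ∘ᶜ swapSuc a))
    ≡⟨ cong (sign a * M 0 (suc a) *_) (detℕ-cong n λ x b _ _ → cong (M (suc x)) (swapSuc-punchInℕ-same a b)) ⟩
  sign a * M 0 (suc a) * detℕ n (minor (suc a) M)
    ≡⟨ sym (ℤ.neg-involutive _) ⟩
  - - (sign a * M 0 (suc a) * detℕ n (minor (suc a) M))
    ≡⟨ cong -_ (sym (negate-left (sign a) (M 0 (suc a)) _)) ⟩
  - laplaceTerm n M (suc a) ∎
... | tri> _ _ a<j with ℕ.m≤n⇒m<n∨m≡n a<j
...   | inj₂ refl rewrite swapSuc-suc a =
  trans (cong (- sign a * M 0 a *_) (detℕ-cong n λ x b _ _ → cong (M (suc x)) (swapSuc-punchInℕ-suc a b)))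
        (negate-left (sign a) (M 0 a) _)
...   | inj₁ a+1<j = laplaceTerm-fixed n M (swapSuc a) j (swapSuc-> a j a+1<j)
  (trans (detℕ-cong n λ x b _ _ → cong (M (suc x)) (swapSuc-punchInℕ-right a j b a+1<j))
         (ih a (minor j M) (ℕ.<-≤-trans a+1<j (ℕ.≤-pred j<n+1))))

detℕ-swapSuc : ∀ n a M → suc a ℕ.< n → detℕ n (M ∘ᶜ swapSuc a) ≡ - detℕ n M
detℕ-swapSuc (suc n) a M a+1<n+1 = begin
  ∑ (suc n) (laplaceTerm n (M ∘ᶜ swapSuc a))
    ≡⟨ ∑-cong (suc n) (λ j j<n+1 → laplaceTerm-swapSuc n a M j a+1<n+1 j<n+1 (detℕ-swapSuc n)) ⟩
  ∑ (suc n) (λ j → - laplaceTerm n M (swapSuc a j))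
    ≡⟨ ∑-neg (suc n) (λ j → laplaceTerm n M (swapSuc a j)) ⟩
  - ∑ (suc n) (λ j → laplaceTerm n M (swapSuc a j))
    ≡⟨ cong -_ (∑-swapSuc (suc n) a (laplaceTerm n M) a+1<n+1) ⟩
  - detℕ (suc n) M ∎

x≡-x⇒x≡0 : ∀ x → x ≡ - x → x ≡ + 0
x≡-x⇒x≡0 (+ zero) _ = refl

swapSuc-equalColumns : ∀ a (M : Matrix) → (∀ i → M i a ≡ M i (suc a)) →
  ∀ i j → (M ∘ᶜ swapSuc a) i j ≡ M i j
swapSuc-equalColumns zero M eq i zero = sym (eq i)
swapSuc-equalColumns zero M eq i (suc zero) = eq i
swapSuc-equalColumns zero M eq i (suc (suc j)) = refl
swapSuc-equalColumns (suc a) M eq i zero = refl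
swapSuc-equalColumns (suc a) M eq i (suc j) = swapSuc-equalColumns a (λ i j → M i (suc j)) eq i j

-- Induction on b: a matrix with equal columns a < b is, up to sign, one with equal columns a < b - 1.
detℕ-equalColumns : ∀ n (M : Matrix) a b → a ℕ.< b → b ℕ.< n → (∀ i → M i a ≡ M i b) →
  detℕ n M ≡ + 0
detℕ-equalColumns n M a (suc b) (s≤s a≤b) b+1<n eq with ℕ.m≤n⇒m<n∨m≡n a≤b
... | inj₂ refl = x≡-x⇒x≡0 (detℕ n M)
  (trans (sym (detℕ-cong n λ i j _ _ → swapSuc-equalColumns a M eq i j)) (detℕ-swapSuc n a M b+1<n))
... | inj₁ a<b = ℤ.neg-injective (trans (sym (detℕ-swapSuc n b M b+1<n))
  (detℕ-equalColumns n (M ∘ᶜ swapSuc b) a b a<b (ℕ.<-trans (ℕ.n<1+n b) b+1<n)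
    λ i → trans (cong (M i) (swapSuc-< b a a<b)) (trans (eq i) (cong (M i) (sym (swapSuc-same b))))))

private
  distrib-middle : ∀ x y s a b d → s * (x * a + y * b) * d ≡ x * (s * a * d) + y * (s * b * d)
  distrib-middle = solve-∀
  distrib-right : ∀ x y s m a b → s * m * (x * a + y * b) ≡ x * (s * m * a) + y * (s * m * b)
  distrib-right = solve-∀

detℕ-linear : ∀ n k (M A B : Matrix) x y → k ℕ.< n →
  (∀ i j → j ≢ k → A i j ≡ M i j) → (∀ i j → j ≢ k → B i j ≡ M i j) →
  (∀ i → M i k ≡ x * A i k + y * B i k) →
  detℕ n M ≡ x * detℕ n A + y * detℕ n B
detℕ-linear (suc n) k M A B x y k<n+1 A≈M B≈M Mk≡ =
  trans (∑-cong (suc n) term-linear) (∑-linear (suc n) x y (laplaceTerm n A) (laplaceTerm n B))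
  where
  term-linear : ∀ j → j ℕ.< suc n → laplaceTerm n M j ≡ x * laplaceTerm n A j + y * laplaceTerm n B j
  term-linear j j<n+1 with j ℕ.≟ k
  ... | yes refl = begin
    sign j * M 0 j * detℕ n (minor j M)
      ≡⟨ cong (λ u → sign j * u * detℕ n (minor j M)) (Mk≡ 0) ⟩
    sign j * (x * A 0 j + y * B 0 j) * detℕ n (minor j M)
      ≡⟨ distrib-middle x y (sign j) (A 0 j) (B 0 j) _ ⟩
    x * (sign j * A 0 j * detℕ n (minor j M)) + y * (sign j * B 0 j * detℕ n (minor j M))
      ≡⟨ cong₂ (λ u v → x * (sign j * A 0 j * u) + y * (sign j * B 0 j * v))
               (sameMinor A≈M) (sameMinor B≈M) ⟩
    x * laplaceTerm n A j + y * laplaceTerm n B j ∎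
    where
    sameMinor : ∀ {N} → (∀ i j′ → j′ ≢ j → N i j′ ≡ M i j′) →
      detℕ n (minor j M) ≡ detℕ n (minor j N)
    sameMinor N≈M = detℕ-cong n λ a b _ _ → sym (N≈M (suc a) (punchInℕ j b) (punchInℕ≢ j b))
  ... | no j≢k with k′ , refl ← punchInℕ-surjective j k j≢k = begin
    sign j * M 0 j * detℕ n (minor j M)
      ≡⟨ cong (sign j * M 0 j *_) minor-linear ⟩
    sign j * M 0 j * (x * detℕ n (minor j A) + y * detℕ n (minor j B))
      ≡⟨ distrib-right x y (sign j) (M 0 j) _ _ ⟩
    x * (sign j * M 0 j * detℕ n (minor j A)) + y * (sign j * M 0 j * detℕ n (minor j B))
      ≡⟨ cong₂ (λ u v → x * (sign j * u * detℕ n (minor j A)) + y * (sign j * v * detℕ n (minor j B)))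
               (sym (A≈M 0 j j≢k)) (sym (B≈M 0 j j≢k)) ⟩
    x * laplaceTerm n A j + y * laplaceTerm n B j ∎
    where
    avoids : ∀ b → b ≢ k′ → punchInℕ j b ≢ punchInℕ j k′
    avoids b b≢k′ eq = b≢k′ (punchInℕ-injective j b k′ eq)
    minor-linear : detℕ n (minor j M) ≡ x * detℕ n (minor j A) + y * detℕ n (minor j B)
    minor-linear = detℕ-linear n k′ (minor j M) (minor j A) (minor j B) x y
      (punchInℕ-<-cancel j k′ n (ℕ.≤-pred j<n+1) k<n+1)
      (λ a b b≢k′ → A≈M (suc a) (punchInℕ j b) (avoids b b≢k′))
      (λ a b b≢k′ → B≈M (suc a) (punchInℕ j b) (avoids b b≢k′))
      (λ a → Mk≡ (suc a))

setColumn : Matrix → ℕ → (ℕ → ℤ) → Matrix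
setColumn M k v i j with j ℕ.≟ k
... | yes _ = v i
... | no _ = M i j

setColumn-same : ∀ M k v i → setColumn M k v i k ≡ v i
setColumn-same M k v i with k ℕ.≟ k
... | yes _ = refl
... | no k≢k = ⊥-elim (k≢k refl)

setColumn-other : ∀ M k v i j → j ≢ k → setColumn M k v i j ≡ M i j
setColumn-other M k v i j j≢k with j ℕ.≟ k
... | yes j≡k = ⊥-elim (j≢k j≡k)
... | no _ = refl

detℕ-scaleAddColumns : ∀ n k (M P : Matrix) c as s → k ℕ.< n → s ℕ.+ length as ℕ.≤ k →
  (∀ i j → j ≢ k → P i j ≡ M i j) →
  (∀ i → P i k ≡ c * M i k + lincomb as (M i) s) →
  detℕ n P ≡ c * detℕ n M
detℕ-scaleAddColumns n k M P c [] s k<n _ P≈M Pk≡ = begin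
  detℕ n P
    ≡⟨ detℕ-linear n k P M M c (+ 0) k<n (λ i j j≢k → sym (P≈M i j j≢k)) (λ i j j≢k → sym (P≈M i j j≢k))
                   (λ i → trans (Pk≡ i) (add-zero c (M i k))) ⟩
  c * detℕ n M + + 0 * detℕ n M
    ≡⟨ drop-zero c (detℕ n M) ⟩
  c * detℕ n M ∎
  where
  add-zero : ∀ c m → c * m + + 0 ≡ c * m + + 0 * m
  add-zero = solve-∀
  drop-zero : ∀ c d → c * d + + 0 * d ≡ c * d
  drop-zero = solve-∀
detℕ-scaleAddColumns n k M P c (a ∷ as) s k<n s+|a∷as|≤k P≈M Pk≡ = begin
  detℕ n P                          ≡⟨ detℕ-linear n k P P′ S (+ 1) a k<n P′≈P S≈P Pk≡-split ⟩
  + 1 * detℕ n P′ + a * detℕ n S    ≡⟨ cong₂ (λ u v → + 1 * u + a * v) P′-det S-det ⟩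
  + 1 * (c * detℕ n M) + a * + 0    ≡⟨ simplify c (detℕ n M) a ⟩
  c * detℕ n M                      ∎
  where
  P′ S : Matrix
  P′ = setColumn M k (λ i → c * M i k + lincomb as (M i) (suc s))
  S = setColumn M k (λ i → M i s)
  s+1+|as|≤k : suc s ℕ.+ length as ℕ.≤ k
  s+1+|as|≤k = subst (ℕ._≤ k) (ℕ.+-suc s (length as)) s+|a∷as|≤k
  s<k : s ℕ.< k
  s<k = ℕ.m+n≤o⇒m≤o (suc s) s+1+|as|≤k
  P′≈P : ∀ i j → j ≢ k → P′ i j ≡ P i j
  P′≈P i j j≢k = trans (setColumn-other M k _ i j j≢k) (sym (P≈M i j j≢k))
  S≈P : ∀ i j → j ≢ k → S i j ≡ P i j
  S≈P i j j≢k = trans (setColumn-other M k _ i j j≢k) (sym (P≈M i j j≢k))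
  regroup : ∀ c m a ms r → c * m + (a * ms + r) ≡ + 1 * (c * m + r) + a * ms
  regroup = solve-∀
  simplify : ∀ c d a → + 1 * (c * d) + a * + 0 ≡ c * d
  simplify = solve-∀
  Pk≡-split : ∀ i → P i k ≡ + 1 * P′ i k + a * S i k
  Pk≡-split i = trans (Pk≡ i) (trans (regroup c (M i k) a (M i s) _)
    (sym (cong₂ (λ u v → + 1 * u + a * v) (setColumn-same M k _ i) (setColumn-same M k _ i))))
  P′-det : detℕ n P′ ≡ c * detℕ n M
  P′-det = detℕ-scaleAddColumns n k M P′ c as (suc s) k<n s+1+|as|≤k
    (λ i j j≢k → setColumn-other M k _ i j j≢k) (λ i → setColumn-same M k _ i)
  S-det : detℕ n S ≡ + 0
  S-det = detℕ-equalColumns n S s k s<k k<n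
    λ i → trans (setColumn-other M k _ i s (ℕ.<⇒≢ s<k)) (sym (setColumn-same M k _ i))

detℕ-rotate : ∀ n k (M : Matrix) → k ℕ.< n → detℕ n (M ∘ᶜ rotate k) ≡ sign k * detℕ n M
detℕ-rotate n zero M _ = sym (ℤ.*-identityˡ _)
detℕ-rotate n (suc k) M k+1<n = begin
  detℕ n ((M ∘ᶜ rotate k) ∘ᶜ swapSuc k)  ≡⟨ detℕ-swapSuc n k (M ∘ᶜ rotate k) k+1<n ⟩
  - detℕ n (M ∘ᶜ rotate k)               ≡⟨ cong -_ (detℕ-rotate n k M (ℕ.<-trans (ℕ.n<1+n k) k+1<n)) ⟩
  - (sign k * detℕ n M)                   ≡⟨ ℤ.neg-distribˡ-* (sign k) (detℕ n M) ⟩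
  sign (suc k) * detℕ n M                 ∎

antidiagonalSign : ℕ → ℤ
antidiagonalSign zero = + 1
antidiagonalSign (suc m) = sign m * antidiagonalSign m

antidiagonalSign-+2 : ∀ m → antidiagonalSign (suc (suc m)) ≡ - antidiagonalSign m
antidiagonalSign-+2 m = begin
  - sign m * (sign m * antidiagonalSign m)   ≡⟨ reassoc (sign m) (antidiagonalSign m) ⟩
  - (sign m * sign m * antidiagonalSign m)   ≡⟨ cong (λ s → - (s * antidiagonalSign m)) (sign-squared m) ⟩
  - (+ 1 * antidiagonalSign m)               ≡⟨ cong -_ (ℤ.*-identityˡ (antidiagonalSign m)) ⟩
  - antidiagonalSign m                       ∎
  where
  reassoc : ∀ s a → - s * (s * a) ≡ - (s * s * a)
  reassoc = solve-∀

detℕ-antidiagonal : ∀ m (M : Matrix) →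
  (∀ i j → suc (i ℕ.+ j) ℕ.< m → M i j ≡ + 0) → (∀ i j → suc (i ℕ.+ j) ≡ m → M i j ≡ + 1) →
  detℕ m M ≡ antidiagonalSign m
detℕ-antidiagonal zero M _ _ = refl
detℕ-antidiagonal (suc m) M above below = begin
  detℕ (suc m) M                                 ≡⟨ ∑-onlyLast m (laplaceTerm m M) first-row-zero ⟩
  sign m * M 0 m * detℕ m (minor m M)
    ≡⟨ cong₂ (λ u v → sign m * u * v) (below 0 m refl) minor-antidiagonal ⟩
  sign m * + 1 * antidiagonalSign m              ≡⟨ cong (_* antidiagonalSign m) (ℤ.*-identityʳ (sign m)) ⟩
  antidiagonalSign (suc m)                       ∎
  where
  first-row-zero : ∀ j → j ℕ.< m → laplaceTerm m M j ≡ + 0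
  first-row-zero j j<m = begin
    sign j * M 0 j * detℕ m (minor j M)
      ≡⟨ cong (λ u → sign j * u * detℕ m (minor j M)) (above 0 j (s≤s j<m)) ⟩
    sign j * + 0 * detℕ m (minor j M)            ≡⟨ cong (_* detℕ m (minor j M)) (ℤ.*-zeroʳ (sign j)) ⟩
    + 0 * detℕ m (minor j M)                     ≡⟨ ℤ.*-zeroˡ (detℕ m (minor j M)) ⟩
    + 0                                          ∎
  inCorner : ∀ a b → suc (a ℕ.+ b) ℕ.≤ m → M (suc a) (punchInℕ m b) ≡ M (suc a) b
  inCorner a b a+b<m = cong (M (suc a)) (punchInℕ-below m b (ℕ.<-≤-trans (s≤s (ℕ.m≤n+m b a)) a+b<m))
  minor-antidiagonal : detℕ m (minor m M) ≡ antidiagonalSign m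
  minor-antidiagonal = detℕ-antidiagonal m (minor m M)
    (λ a b a+b+1<m → trans (inCorner a b (ℕ.<⇒≤ a+b+1<m)) (above (suc a) b (s≤s a+b+1<m)))
    (λ a b a+b+1≡m → trans (inCorner a b (ℕ.≤-reflexive a+b+1≡m)) (below (suc a) b (cong suc a+b+1≡m)))

sumFin≡∑ : ∀ n (F : Fin n → ℤ) (g : ℕ → ℤ) → (∀ j → F j ≡ g (toℕ j)) →
  sumFin n F ≡ ∑ n g
sumFin≡∑ zero F g _ = refl
sumFin≡∑ (suc n) F g F≡g =
  cong₂ _+_ (F≡g Fin.zero) (sumFin≡∑ n (λ j → F (Fin.suc j)) (λ j → g (suc j)) (λ j → F≡g (Fin.suc j)))

det≡detℕ : ∀ n (M : Fin n → Fin n → ℤ) (N : Matrix) → (∀ i j → M i j ≡ N (toℕ i) (toℕ j)) →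
  det n M ≡ detℕ n N
det≡detℕ zero M N _ = refl
det≡detℕ (suc n) M N M≡N = sumFin≡∑ (suc n) _ (laplaceTerm n N) λ j →
  cong₂ _*_ (cong₂ _*_ (-1^≡sign (toℕ j)) (M≡N Fin.zero j))
            (det≡detℕ n _ (minor (toℕ j) N) λ a b →
              trans (M≡N (Fin.suc a) (punchIn j b)) (cong (N (suc (toℕ a))) (toℕ-punchIn j b)))

ℤ-induction : (P : ℤ → Set) → P (+ 0) →
  (∀ x → P x → P (x + + 1)) → (∀ x → P (x + + 1) → P x) → ∀ x → P x
ℤ-induction P P0 up down = λ
  { (+ n) → nonNegative n
  ; -[1+ n ] → negative n }
  where
  nonNegative : ∀ n → P (+ n)
  nonNegative zero = P0
  nonNegative (suc n) = subst P (cong +_ (ℕ.+-comm n 1)) (up (+ n) (nonNegative n))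
  negative : ∀ n → P -[1+ n ]
  negative zero = down -[1+ 0 ] P0
  negative (suc n) = down -[1+ suc n ] (subst P (sym (ℤ.[1+m]⊖[1+n]≡m⊖n 0 (suc n))) (negative n))

ℤ-induction-from : ∀ b (P : ℤ → Set) → P b →
  (∀ x → P x → P (x + + 1)) → (∀ x → P (x + + 1) → P x) → ∀ x → P x
ℤ-induction-from b P Pb up down x = subst P (x-b+b x b) (ℤ-induction (λ y → P (y + b))
  (subst P (sym (ℤ.+-identityˡ b)) Pb)
  (λ y P[y+b] → subst P (reassoc y b) (up (y + b) P[y+b]))
  (λ y P[y+1+b] → down (y + b) (subst P (sym (reassoc y b)) P[y+1+b]))
  (x - b))
  where
  reassoc : ∀ y b → y + b + + 1 ≡ y + + 1 + b
  reassoc = solve-∀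
  x-b+b : ∀ x b → x - b + b ≡ x
  x-b+b = solve-∀

alternating-unique : ∀ (g h : ℤ → ℤ) → (∀ n → g (n + + 1) ≡ - g n) → (∀ n → h (n + + 1) ≡ - h n) →
  ∀ b → g b ≡ h b → ∀ n → g n ≡ h n
alternating-unique g h g-alt h-alt b gb≡hb = ℤ-induction-from b (λ n → g n ≡ h n) gb≡hb
  (λ n gn≡hn → trans (g-alt n) (trans (cong -_ gn≡hn) (sym (h-alt n))))
  (λ n g≡h → ℤ.neg-injective (trans (sym (g-alt n)) (trans g≡h (h-alt n))))

isolate-middle : ∀ {a b y p} → a ≡ b + y + p → y ≡ a - b - p
isolate-middle {a} {b} {y} {p} a≡b+y+p = trans (isolate b y p) (cong (λ z → z - b - p) (sym a≡b+y+p))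
  where
  isolate : ∀ b y p → y ≡ b + y + p - b - p
  isolate = solve-∀

/ℕ-exact : ∀ a d .{{_ : ℕ.NonZero d}} → + d ∣ a → + d * (a /ℕ d) ≡ a
/ℕ-exact a d (divides q a≡q*d) = begin
  + d * (a /ℕ d)                   ≡⟨ ℤ.*-comm (+ d) (a /ℕ d) ⟩
  (a /ℕ d) * + d                   ≡⟨ sym (ℤ.+-identityˡ _) ⟩
  + 0 + (a /ℕ d) * + d             ≡⟨ cong (λ r → + r + (a /ℕ d) * + d) (sym remainder≡0) ⟩
  + (a %ℕ d) + (a /ℕ d) * + d      ≡⟨ sym (a≡a%ℕn+[a/ℕn]*n a d) ⟩
  a                                ∎
  where
  q′ = a /ℕ d
  isolate : ∀ r q′ d → r ≡ (r + q′ * d) - q′ * d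
  isolate = solve-∀
  factor : ∀ q q′ d → q * d - q′ * d ≡ (q - q′) * d
  factor = solve-∀
  d∣remainder : + d ∣ + (a %ℕ d)
  d∣remainder = divides (q - q′) (begin
    + (a %ℕ d)                          ≡⟨ isolate (+ (a %ℕ d)) q′ (+ d) ⟩
    (+ (a %ℕ d) + q′ * + d) - q′ * + d  ≡⟨ cong (_- q′ * + d) (sym (a≡a%ℕn+[a/ℕn]*n a d)) ⟩
    a - q′ * + d                        ≡⟨ cong (_- q′ * + d) a≡q*d ⟩
    q * + d - q′ * + d                  ≡⟨ factor q q′ (+ d) ⟩
    (q - q′) * + d                      ∎)
  remainder≡0 : a %ℕ d ≡ 0
  remainder≡0 with a %ℕ d | n%ℕd<d a d | ∣⇒∣ᵤ d∣remainder
  ... | zero | _ | _ = refl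
  ... | suc r | r<d | d∣r = ⊥-elim (>⇒∤ r<d d∣r)

sign-∣x+1∣ : ∀ x → sign ∣ x + + 1 ∣ ≡ - sign ∣ x ∣
sign-∣x+1∣ (+ n) = cong sign (ℕ.+-comm n 1)
sign-∣x+1∣ -[1+ zero ] = refl
sign-∣x+1∣ -[1+ suc n ] = sym (ℤ.neg-involutive _)

negOnePow-suc : ∀ x → negOnePow (x + + 1) ≡ - negOnePow x
negOnePow-suc x = trans (-1^≡sign ∣ x + + 1 ∣) (trans (sign-∣x+1∣ x) (cong -_ (sym (-1^≡sign ∣ x ∣))))

negOnePow-pred : ∀ x → negOnePow (x - + 1) ≡ - negOnePow x
negOnePow-pred x = begin
  negOnePow (x - + 1)                  ≡⟨ sym (ℤ.neg-involutive _) ⟩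
  - - negOnePow (x - + 1)              ≡⟨ cong -_ (sym (negOnePow-suc (x - + 1))) ⟩
  - negOnePow (x - + 1 + + 1)          ≡⟨ cong (λ y → - negOnePow y) (-1+1 x) ⟩
  - negOnePow x                        ∎
  where
  -1+1 : ∀ x → x - + 1 + + 1 ≡ x
  -1+1 = solve-∀

antidiagonalSign≡negOnePow : ∀ r → antidiagonalSign (suc (suc r)) ≡ negOnePow (- + r + + ((r ℕ.+ 3) / 2))
antidiagonalSign≡negOnePow zero = refl
antidiagonalSign≡negOnePow (suc zero) = refl
antidiagonalSign≡negOnePow (suc (suc r)) = begin
  antidiagonalSign (suc (suc (suc (suc r))))          ≡⟨ antidiagonalSign-+2 (suc (suc r)) ⟩
  - antidiagonalSign (suc (suc r))                    ≡⟨ cong -_ (antidiagonalSign≡negOnePow r) ⟩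
  - negOnePow (- + r + + C)                           ≡⟨ sym (negOnePow-pred (- + r + + C)) ⟩
  negOnePow (- + r + + C - + 1)                       ≡⟨ cong negOnePow (reindex (+ r) (+ C)) ⟩
  negOnePow (- + suc (suc r) + + suc C)
    ≡⟨ cong (λ q → negOnePow (- + suc (suc r) + + q)) (sym (m/n≡1+[m∸n]/n {suc (suc r) ℕ.+ 3} {2} (s≤s (s≤s z≤n)))) ⟩
  negOnePow (- + suc (suc r) + + ((suc (suc r) ℕ.+ 3) / 2)) ∎
  where
  C = (r ℕ.+ 3) / 2
  reindex : ∀ R C → - R + C - + 1 ≡ - (+ 1 + (+ 1 + R)) + (+ 1 + C)
  reindex = solve-∀

-- Falling factorials

fallingProd-suc : ∀ t x → fallingProd (x + + 1) (suc t) ≡ fallingProd x (suc t) + + suc t * fallingProd x t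
fallingProd-suc zero x = shift x
  where
  shift : ∀ x → (x + + 1) * + 1 ≡ x * + 1 + + 1 * + 1
  shift = solve-∀
fallingProd-suc (suc t) x = begin
  (x + + 1) * fallingProd (x + + 1 - + 1) (suc t)  ≡⟨ cong (λ y → (x + + 1) * fallingProd y (suc t)) (+1-1 x) ⟩
  (x + + 1) * (x * B)                              ≡⟨ split x B ⟩
  x * (x * B) + x * B                              ≡⟨ cong (λ z → x * z + x * B) ih ⟩
  x * (Y + + suc t * B) + x * B                    ≡⟨ collect x Y B (+ suc t) ⟩
  x * Y + + suc (suc t) * (x * B)                  ∎
  where
  B = fallingProd (x - + 1) t
  Y = fallingProd (x - + 1) (suc t)
  +1-1 : ∀ x → x + + 1 - + 1 ≡ x
  +1-1 = solve-∀
  -1+1 : ∀ x → x - + 1 + + 1 ≡ x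
  -1+1 = solve-∀
  split : ∀ x B → (x + + 1) * (x * B) ≡ x * (x * B) + x * B
  split = solve-∀
  collect : ∀ x Y B s → x * (Y + s * B) + x * B ≡ x * Y + (+ 1 + s) * (x * B)
  collect = solve-∀
  ih : x * B ≡ Y + + suc t * B
  ih = subst (λ y → fallingProd y (suc t) ≡ Y + + suc t * B) (-1+1 x) (fallingProd-suc t (x - + 1))

fallingProd-divisible : ∀ t x → + (t !) ∣ fallingProd x t
fallingProd-divisible zero x = ∣-refl
fallingProd-divisible (suc t) = ℤ-induction (λ x → + (suc t !) ∣ fallingProd x (suc t)) (divides (+ 0) refl)
  (λ x ∣x → subst (+ (suc t !) ∣_) (sym (fallingProd-suc t x)) (∣m∣n⇒∣m+n ∣x (∣step x)))
  (λ x ∣x+1 → ∣m+n∣n⇒∣m (subst (+ (suc t !) ∣_) (fallingProd-suc t x) ∣x+1) (∣step x))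
  where
  ∣step : ∀ x → + (suc t !) ∣ + suc t * fallingProd x t
  ∣step x = subst (_∣ + suc t * fallingProd x t) (sym (ℤ.pos-* (suc t) (t !)))
    (*-monoʳ-∣ (+ suc t) (fallingProd-divisible t x))

factorial*binomPoly : ∀ t k → + (t !) * binomPoly (suc t) k ≡ fallingProd (k + + suc t) t
factorial*binomPoly t k = /ℕ-exact (fallingProd (k + + suc t) t) (t !) {{t !≢0}} (fallingProd-divisible t _)

fallingProd-self : ∀ t → fallingProd (+ t) t ≡ + (t !)
fallingProd-self zero = refl
fallingProd-self (suc t) = trans (cong (+ suc t *_) (fallingProd-self t)) (sym (ℤ.pos-* (suc t) (t !)))

fallingProd-below : ∀ u t → u ℕ.< t → fallingProd (+ u) t ≡ + 0
fallingProd-below zero (suc t) _ = refl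
fallingProd-below (suc u) (suc t) (s≤s u<t) =
  trans (cong (+ suc u *_) (fallingProd-below u t u<t)) (ℤ.*-zeroʳ (+ suc u))

binomPoly-at-1 : ∀ t → binomPoly (suc t) (- + 1) ≡ + 1
binomPoly-at-1 t = ℤ.*-cancelˡ-≡ (+ (t !)) _ (+ 1) {{t !≢0}} (begin
  + (t !) * binomPoly (suc t) (- + 1)   ≡⟨ factorial*binomPoly t (- + 1) ⟩
  fallingProd (- + 1 + + suc t) t       ≡⟨ cong (λ y → fallingProd y t) (ℤ.-m+n≡n⊖m 1 (suc t)) ⟩
  fallingProd (+ t) t                   ≡⟨ fallingProd-self t ⟩
  + (t !)                               ≡⟨ sym (ℤ.*-identityʳ (+ (t !))) ⟩
  + (t !) * + 1                         ∎)

binomPoly-root : ∀ t j → j ℕ.< t → binomPoly (suc t) (- + suc (suc j)) ≡ + 0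
binomPoly-root t j j<t = ℤ.*-cancelˡ-≡ (+ (t !)) _ (+ 0) {{t !≢0}} (begin
  + (t !) * binomPoly (suc t) (- + suc (suc j))  ≡⟨ factorial*binomPoly t (- + suc (suc j)) ⟩
  fallingProd (- + suc (suc j) + + suc t) t      ≡⟨ cong (λ y → fallingProd y t) index ⟩
  fallingProd (+ (t ℕ.∸ suc j)) t
    ≡⟨ fallingProd-below (t ℕ.∸ suc j) t (ℕ.∸-monoʳ-< (s≤s z≤n) j<t) ⟩
  + 0                                            ≡⟨ sym (ℤ.*-zeroʳ (+ (t !))) ⟩
  + (t !) * + 0                                  ∎)
  where
  index : - + suc (suc j) + + suc t ≡ + (t ℕ.∸ suc j)
  index = trans (ℤ.-m+n≡n⊖m (suc (suc j)) (suc t)) (trans (ℤ.[1+m]⊖[1+n]≡m⊖n t (suc j)) (ℤ.⊖-≥ j<t))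

-- Linear recurrences

-- scaledBinom s k = (s - 1)! · binom(k + s, s - 1), a polynomial of degree s - 1 in k
scaledBinom : ℕ → ℤ → ℤ
scaledBinom zero k = + 0
scaledBinom (suc t) k = fallingProd (k + + suc t) t

scaledBinom-suc : ∀ s k → scaledBinom (suc s) k ≡ scaledBinom (suc s) (k - + 1) + + s * scaledBinom s k
scaledBinom-suc zero k = refl
scaledBinom-suc (suc t) k = begin
  fallingProd (k + + suc (suc t)) (suc t)            ≡⟨ cong (λ z → fallingProd z (suc t)) (reindex k (+ suc t)) ⟩
  fallingProd (y + + 1) (suc t)                      ≡⟨ fallingProd-suc t y ⟩
  fallingProd y (suc t) + + suc t * fallingProd y t
    ≡⟨ cong (λ z → fallingProd y (suc t) + + suc t * fallingProd z t) (reindex′ k (+ suc t)) ⟩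
  fallingProd y (suc t) + + suc t * fallingProd (k + + suc t) t ∎
  where
  y = k - + 1 + + suc (suc t)
  reindex : ∀ k S → k + (+ 1 + S) ≡ k - + 1 + (+ 1 + S) + + 1
  reindex = solve-∀
  reindex′ : ∀ k S → k - + 1 + (+ 1 + S) ≡ k + S
  reindex′ = solve-∀

∇ : (ℤ → ℤ) → ℤ → ℤ
∇ h y = h y - h (y - + 1)

∇-recurrence : ∀ s c (h : ℤ → ℤ) → (∀ k → h (k + + 2) ≡ h (k + + 1) + h k + c * scaledBinom (suc s) k) →
  ∀ k → ∇ h (k + + 2) ≡ ∇ h (k + + 1) + ∇ h k + (c * + s) * scaledBinom s k
∇-recurrence s c h rec k = begin
  h (k + + 2) - h (k + + 2 - + 1)                    ≡⟨ cong (λ y → h (k + + 2) - h y) (+2-1 k) ⟩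
  h (k + + 2) - a                                    ≡⟨ cong (_- a) (rec k) ⟩
  a + b + c * G₁ - a                                 ≡⟨ cong (λ g → a + b + c * g - a) (scaledBinom-suc s k) ⟩
  a + b + c * (G₀ + + s * S) - a                     ≡⟨ regroup a b e c G₀ (+ s) S ⟩
  (b + e + c * G₀) - b + (b - e) + (c * + s) * S     ≡⟨ cong (λ u → u - b + (b - e) + (c * + s) * S) (sym rec′) ⟩
  a - b + (b - e) + (c * + s) * S                    ≡⟨ cong (λ y → a - h y + (b - e) + (c * + s) * S) (sym (+1-1 k)) ⟩
  ∇ h (k + + 1) + ∇ h k + (c * + s) * S              ∎
  where
  a = h (k + + 1)
  b = h k
  e = h (k - + 1)
  G₁ = scaledBinom (suc s) k
  G₀ = scaledBinom (suc s) (k - + 1)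
  S = scaledBinom s k
  +2-1 : ∀ k → k + + 2 - + 1 ≡ k + + 1
  +2-1 = solve-∀
  +1-1 : ∀ k → k + + 1 - + 1 ≡ k
  +1-1 = solve-∀
  regroup : ∀ a b e c G₀ s S → a + b + c * (G₀ + s * S) - a ≡ (b + e + c * G₀) - b + (b - e) + (c * s) * S
  regroup = solve-∀
  rec′ : a ≡ b + e + c * G₀
  rec′ = trans (cong h (sym (-1+2 k))) (trans (rec (k - + 1)) (cong (λ y → h y + e + c * G₀) (-1+1 k)))
    where
    -1+2 : ∀ k → k - + 1 + + 2 ≡ k + + 1
    -1+2 = solve-∀
    -1+1 : ∀ k → k - + 1 + + 1 ≡ k
    -1+1 = solve-∀

-- mulXMinus1 p as = p + (X - 1) · as, lists being coefficient lists with the constant term first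
mulXMinus1 : ℤ → List ℤ → List ℤ
mulXMinus1 p [] = p ∷ []
mulXMinus1 p (a ∷ as) = (p - a) ∷ mulXMinus1 a as

lincomb-mulXMinus1 : ∀ as p v s →
  lincomb (mulXMinus1 p as) v s ≡ p * v s + lincomb as (λ l → v (suc l) - v l) s
lincomb-mulXMinus1 [] p v s = refl
lincomb-mulXMinus1 (a ∷ as) p v s =
  trans (cong (λ y → (p - a) * v s + y) (lincomb-mulXMinus1 as a v (suc s))) (regroup p a (v s) (v (suc s)) _)
  where
  regroup : ∀ p a x x′ y → (p - a) * x + (a * x′ + y) ≡ p * x + (a * (x′ - x) + y)
  regroup = solve-∀

mulXMinus1-monic : ∀ p as →
  ∃ λ bs → mulXMinus1 p (as ++ + 1 ∷ []) ≡ bs ++ + 1 ∷ [] × length bs ≡ suc (length as)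
mulXMinus1-monic p [] = (p - + 1) ∷ [] , refl , refl
mulXMinus1-monic p (a ∷ as) with bs , eq , len ← mulXMinus1-monic a as =
  (p - a) ∷ bs , cong ((p - a) ∷_) eq , cong suc len

charPoly : ℕ → List ℤ
charPoly zero = - + 1 ∷ - + 1 ∷ + 1 ∷ []
charPoly (suc s) = mulXMinus1 (+ 0) (charPoly s)

charPoly-shape : ∀ s → ∃ λ bs → charPoly s ≡ sign (suc s) ∷ bs ++ + 1 ∷ [] × length bs ≡ suc s
charPoly-shape zero = - + 1 ∷ [] , refl , refl
charPoly-shape (suc s)
  with bs , eq , len ← charPoly-shape s
  with bs′ , eq′ , len′ ← mulXMinus1-monic (sign (suc s)) bs =
  bs′ , trans (cong (mulXMinus1 (+ 0)) eq) (cong₂ _∷_ (ℤ.+-identityˡ (- sign (suc s))) eq′) , trans len′ (cong suc len)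

seqFrom : (ℤ → ℤ) → ℤ → ℕ → ℤ
seqFrom h x l = h (x + + l)

charPoly-annihilates : ∀ s c (h : ℤ → ℤ) → (∀ k → h (k + + 2) ≡ h (k + + 1) + h k + c * scaledBinom s k) →
  ∀ x → lincomb (charPoly s) (seqFrom h x) 0 ≡ + 0
charPoly-annihilates zero c h rec x = begin
  - + 1 * h (x + + 0) + (- + 1 * h (x + + 1) + (+ 1 * h (x + + 2) + + 0))
    ≡⟨ cong₂ (λ u w → - + 1 * h u + (- + 1 * h (x + + 1) + (+ 1 * w + + 0))) (ℤ.+-identityʳ x) (rec x) ⟩
  - + 1 * h x + (- + 1 * h (x + + 1) + (+ 1 * (h (x + + 1) + h x + c * + 0) + + 0))
    ≡⟨ cancel (h x) (h (x + + 1)) c ⟩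
  + 0 ∎
  where
  cancel : ∀ a b c → - + 1 * a + (- + 1 * b + (+ 1 * (b + a + c * + 0) + + 0)) ≡ + 0
  cancel = solve-∀
charPoly-annihilates (suc s) c h rec x = begin
  lincomb (mulXMinus1 (+ 0) (charPoly s)) (seqFrom h x) 0
    ≡⟨ lincomb-mulXMinus1 (charPoly s) (+ 0) (seqFrom h x) 0 ⟩
  + 0 * h (x + + 0) + lincomb (charPoly s) (λ l → h (x + + suc l) - h (x + + l)) 0
    ≡⟨ cong (λ y → + 0 * h (x + + 0) + y) (lincomb-cong (charPoly s) _ _ 0 λ l _ → differences l) ⟩
  + 0 * h (x + + 0) + lincomb (charPoly s) (seqFrom (∇ h) (x + + 1)) 0
    ≡⟨ cong (λ y → + 0 * h (x + + 0) + y)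
            (charPoly-annihilates s (c * + s) (∇ h) (∇-recurrence s c h rec) (x + + 1)) ⟩
  + 0 * h (x + + 0) + + 0
    ≡⟨ ℤ.+-identityʳ (+ 0 * h (x + + 0)) ⟩
  + 0 ∎
  where
  shift : ∀ x L → x + (+ 1 + L) ≡ x + + 1 + L
  shift = solve-∀
  shift′ : ∀ x L → x + L ≡ x + + 1 + L - + 1
  shift′ = solve-∀
  differences : ∀ l → h (x + + suc l) - h (x + + l) ≡ ∇ h (x + + 1 + + l)
  differences l = cong₂ (λ u w → h u - h w) (shift x (+ l)) (shift′ x (+ l))

-- Hankel determinants of hyperfibonacci numbers

hyperfib-zero : ∀ r → hyperfib r 0 ≡ 0
hyperfib-zero zero = refl
hyperfib-zero (suc r) = hyperfib-zero r

hyperfib-one : ∀ r → hyperfib r 1 ≡ 1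
hyperfib-one zero = refl
hyperfib-one (suc r) = cong₂ ℕ._+_ (hyperfib-zero r) (hyperfib-one r)

hankelℕ : (ℤ → ℤ) → ℤ → Matrix
hankelℕ f n i j = f (n + + i + + j)

hankelℕ-suc : ∀ f n i j → hankelℕ f (n + + 1) i j ≡ hankelℕ f n i (suc j)
hankelℕ-suc f n i j = cong f (shift n (+ i) (+ j))
  where
  shift : ∀ n i L → n + + 1 + i + L ≡ n + i + (+ 1 + L)
  shift = solve-∀

hankel-index : ∀ n i j → n + + i + + j ≡ n + + (i ℕ.+ j)
hankel-index n i j = trans (ℤ.+-assoc n (+ i) (+ j)) (cong (_+_ n) (sym (ℤ.pos-+ i j)))

module HyperfibonacciHankel (t : ℕ) (f : ℤ → ℤ) (hyp : IsHyperfibZ (suc t) f) where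

  r m : ℕ
  r = suc t
  m = suc (suc r)

  recurrence : ∀ k → f (k + + 2) ≡ f (k + + 1) + f k + binomPoly r k
  recurrence = proj₁ hyp

  f-0 : f (+ 0) ≡ + 0
  f-0 = trans (proj₂ hyp 0) (cong +_ (hyperfib-zero r))

  f-1 : f (+ 1) ≡ + 1
  f-1 = trans (proj₂ hyp 1) (cong +_ (hyperfib-one r))

  -- Clearing the denominator t! makes the inhomogeneous term scaledBinom r.
  annihilated : ∀ x → lincomb (charPoly r) (seqFrom f x) 0 ≡ + 0
  annihilated x = ℤ.*-cancelˡ-≡ (+ (t !)) _ (+ 0) {{t !≢0}} (begin
    + (t !) * lincomb (charPoly r) (seqFrom f x) 0  ≡⟨ sym (lincomb-scale (charPoly r) (+ (t !)) (seqFrom f x) 0) ⟩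
    lincomb (charPoly r) (seqFrom h x) 0            ≡⟨ charPoly-annihilates r (+ 1) h h-recurrence x ⟩
    + 0                                             ≡⟨ sym (ℤ.*-zeroʳ (+ (t !))) ⟩
    + (t !) * + 0                                   ∎)
    where
    h : ℤ → ℤ
    h y = + (t !) * f y
    distrib : ∀ d a b p → d * (a + b + p) ≡ d * a + d * b + + 1 * (d * p)
    distrib = solve-∀
    h-recurrence : ∀ k → h (k + + 2) ≡ h (k + + 1) + h k + + 1 * scaledBinom r k
    h-recurrence k = trans (cong (+ (t !) *_) (recurrence k)) (trans (distrib (+ (t !)) (f (k + + 1)) (f k) _)
      (cong (λ y → h (k + + 1) + h k + + 1 * y) (factorial*binomPoly t k)))

  bs : List ℤ
  bs = proj₁ (charPoly-shape r)

  c : ℤ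
  c = - sign (suc r)

  recurrence-order-m : ∀ x → f (x + + m) ≡ c * f x + lincomb (map -_ bs) (seqFrom f x) 1
  recurrence-order-m x = begin
    f (x + + m)                                ≡⟨ solve-last (sign (suc r) * f x) (lincomb bs v 1) (f (x + + m)) ⟩
    (a + (A + + 1 * f (x + + m))) + (- a + - A) ≡⟨ cong (_+ (- a + - A)) zero-sum ⟩
    + 0 + (- a + - A)                          ≡⟨ ℤ.+-identityˡ _ ⟩
    - a + - A                                  ≡⟨ cong₂ _+_ (ℤ.neg-distribˡ-* (sign (suc r)) (f x))
                                                                (sym (lincomb-neg bs v 1)) ⟩
    c * f x + lincomb (map -_ bs) v 1          ∎
    where
    v = seqFrom f x
    a = sign (suc r) * f x
    A = lincomb bs v 1
    solve-last : ∀ a A F → F ≡ (a + (A + + 1 * F)) + (- a + - A)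
    solve-last = solve-∀
    zero-sum : a + (A + + 1 * f (x + + m)) ≡ + 0
    zero-sum = begin
      a + (A + + 1 * f (x + + m))
        ≡⟨ cong₂ (λ y l → sign (suc r) * f y + (A + + 1 * f (x + + suc l)))
                 (sym (ℤ.+-identityʳ x)) (sym (proj₂ (proj₂ (charPoly-shape r)))) ⟩
      sign (suc r) * v 0 + (A + + 1 * v (1 ℕ.+ length bs))
        ≡⟨ cong (λ y → sign (suc r) * v 0 + y) (sym (lincomb-snoc bs (+ 1) v 1)) ⟩
      lincomb (sign (suc r) ∷ bs ++ + 1 ∷ []) v 0
        ≡⟨ cong (λ cs → lincomb cs v 0) (sym (proj₁ (proj₂ (charPoly-shape r)))) ⟩
      lincomb (charPoly r) v 0
        ≡⟨ annihilated x ⟩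
      + 0 ∎

  D : ℤ → ℤ
  D n = detℕ m (hankelℕ f n)

  -- hankelℕ f n with its first column moved to the end and the other columns shifted left
  shiftedHankel : ℤ → Matrix
  shiftedHankel n = setColumn (hankelℕ f (n + + 1)) (suc r) (λ i → hankelℕ f n i 0)

  det-shiftedHankel : ∀ n → detℕ m (shiftedHankel n) ≡ sign (suc r) * D n
  det-shiftedHankel n = trans (detℕ-cong m rotated) (detℕ-rotate m (suc r) (hankelℕ f n) (ℕ.n<1+n (suc r)))
    where
    rotated : ∀ i j → i ℕ.< m → j ℕ.< m → shiftedHankel n i j ≡ (hankelℕ f n ∘ᶜ rotate (suc r)) i j
    rotated i j _ j<m with ℕ.m≤n⇒m<n∨m≡n (ℕ.≤-pred j<m)
    ... | inj₂ refl = trans (setColumn-same _ (suc r) _ i) (cong (hankelℕ f n i) (sym (rotate-same (suc r))))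
    ... | inj₁ j<r+1 = trans (setColumn-other _ (suc r) _ i j (ℕ.<⇒≢ j<r+1))
                             (trans (hankelℕ-suc f n i j) (cong (hankelℕ f n i) (sym (rotate-< (suc r) j j<r+1))))

  -- The order-m recurrence writes the last column of hankelℕ f (n + 1) as c times that of
  -- shiftedHankel n plus a combination of the columns the two matrices share.
  D-suc≡c*det-shiftedHankel : ∀ n → D (n + + 1) ≡ c * detℕ m (shiftedHankel n)
  D-suc≡c*det-shiftedHankel n = detℕ-scaleAddColumns m (suc r) Q P c (map -_ bs) 0 (ℕ.n<1+n (suc r))
    (ℕ.≤-reflexive |bs|≡r+1) (λ i j j≢r+1 → sym (setColumn-other P (suc r) _ i j j≢r+1)) lastColumn
    where
    P Q : Matrix
    P = hankelℕ f (n + + 1)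
    Q = shiftedHankel n
    |bs|≡r+1 : length (map -_ bs) ≡ suc r
    |bs|≡r+1 = trans (length-map -_ bs) (proj₂ (proj₂ (charPoly-shape r)))
    Q≡seqFrom : ∀ i l → l ℕ.< length (map -_ bs) → Q i l ≡ seqFrom f (n + + i) (suc l)
    Q≡seqFrom i l l<r+1 = trans (setColumn-other P (suc r) _ i l (ℕ.<⇒≢ (subst (l ℕ.<_) |bs|≡r+1 l<r+1)))
                                (hankelℕ-suc f n i l)
    lastColumn : ∀ i → P i (suc r) ≡ c * Q i (suc r) + lincomb (map -_ bs) (Q i) 0
    lastColumn i = begin
      f (n + + 1 + + i + + suc r)                                    ≡⟨ hankelℕ-suc f n i (suc r) ⟩
      f (n + + i + + m)                                              ≡⟨ recurrence-order-m (n + + i) ⟩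
      c * f (n + + i) + lincomb (map -_ bs) (seqFrom f (n + + i)) 1
        ≡⟨ cong₂ (λ y z → c * y + z)
                 (sym (trans (setColumn-same P (suc r) _ i) (cong f (ℤ.+-identityʳ (n + + i)))))
                 (sym (trans (lincomb-cong (map -_ bs) (Q i) _ 0 (Q≡seqFrom i))
                             (lincomb-shift (map -_ bs) (seqFrom f (n + + i)) 0))) ⟩
      c * Q i (suc r) + lincomb (map -_ bs) (Q i) 0                  ∎

  D-suc : ∀ n → D (n + + 1) ≡ - D n
  D-suc n = begin
    D (n + + 1)                                  ≡⟨ D-suc≡c*det-shiftedHankel n ⟩
    - sign (suc r) * detℕ m (shiftedHankel n)     ≡⟨ cong (- sign (suc r) *_) (det-shiftedHankel n) ⟩
    - sign (suc r) * (sign (suc r) * D n)        ≡⟨ reassoc (sign (suc r)) (D n) ⟩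
    - (sign (suc r) * sign (suc r) * D n)        ≡⟨ cong (λ s → - (s * D n)) (sign-squared (suc r)) ⟩
    - (+ 1 * D n)                                ≡⟨ cong -_ (ℤ.*-identityˡ (D n)) ⟩
    - D n                                        ∎
    where
    reassoc : ∀ s d → - s * (s * d) ≡ - (s * s * d)
    reassoc = solve-∀

  -- Run the recurrence backwards from F₀ = 0, F₁ = 1: binom(k + r, r − 1) is 1 at k = −1 and
  -- vanishes at k = −2, …, −r.
  f-vanishes-pair : ∀ d → d ℕ.< r → f (- + d) ≡ + 0 × f (- + suc d) ≡ + 0
  f-vanishes-pair zero _ = f-0 , (begin
    f (- + 1)                                  ≡⟨ isolate-middle (recurrence (- + 1)) ⟩
    f (+ 1) - f (+ 0) - binomPoly r (- + 1)    ≡⟨ cong₂ (λ u w → u - w - binomPoly r (- + 1)) f-1 f-0 ⟩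
    + 1 - + 0 - binomPoly r (- + 1)            ≡⟨ cong (λ u → + 1 - + 0 - u) (binomPoly-at-1 t) ⟩
    + 0                                        ∎)
  f-vanishes-pair (suc d) (s≤s d<t) with f[-d]≡0 , f[-d-1]≡0 ← f-vanishes-pair d (ℕ.<-trans d<t (ℕ.n<1+n t)) =
    f[-d-1]≡0 , (begin
    f k                                        ≡⟨ isolate-middle (recurrence k) ⟩
    f (k + + 2) - f (k + + 1) - binomPoly r k  ≡⟨ cong₂ (λ u w → u - w - binomPoly r k) f[k+2]≡0 f[k+1]≡0 ⟩
    + 0 - + 0 - binomPoly r k                  ≡⟨ cong (λ u → + 0 - + 0 - u) (binomPoly-root t d d<t) ⟩
    + 0                                        ∎)
    where
    k = - + suc (suc d)
    +2 : ∀ D → - (+ 1 + (+ 1 + D)) + + 2 ≡ - D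
    +2 = solve-∀
    +1 : ∀ D → - (+ 1 + (+ 1 + D)) + + 1 ≡ - (+ 1 + D)
    +1 = solve-∀
    f[k+2]≡0 : f (k + + 2) ≡ + 0
    f[k+2]≡0 = trans (cong f (+2 (+ d))) f[-d]≡0
    f[k+1]≡0 : f (k + + 1) ≡ + 0
    f[k+1]≡0 = trans (cong f (+1 (+ d))) f[-d-1]≡0

  f-vanishes : ∀ d → d ℕ.≤ r → f (- + d) ≡ + 0
  f-vanishes zero _ = f-0
  f-vanishes (suc d) d+1≤r = proj₂ (f-vanishes-pair d d+1≤r)

  D-base : D (- + r) ≡ antidiagonalSign m
  D-base = detℕ-antidiagonal m (hankelℕ f (- + r)) zeros ones
    where
    zeros : ∀ i j → suc (i ℕ.+ j) ℕ.< m → f (- + r + + i + + j) ≡ + 0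
    zeros i j (s≤s (s≤s i+j≤r)) =
      trans (cong f index) (f-vanishes (r ℕ.∸ (i ℕ.+ j)) (ℕ.m∸n≤m r (i ℕ.+ j)))
      where
      index : - + r + + i + + j ≡ - + (r ℕ.∸ (i ℕ.+ j))
      index = trans (hankel-index (- + r) i j)
        (trans (ℤ.-m+n≡n⊖m r (i ℕ.+ j)) (trans (ℤ.⊖-swap (i ℕ.+ j) r) (cong -_ (ℤ.⊖-≥ i+j≤r))))
    cancel : ∀ R → - R + (+ 1 + R) ≡ + 1
    cancel = solve-∀
    ones : ∀ i j → suc (i ℕ.+ j) ≡ m → f (- + r + + i + + j) ≡ + 1
    ones i j i+j+1≡m = trans (cong f (trans (hankel-index (- + r) i j)
      (trans (cong (λ l → - + r + + l) (ℕ.suc-injective i+j+1≡m)) (cancel (+ r))))) f-1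

  D≡negOnePow : ∀ n → D n ≡ negOnePow (n + + ((r ℕ.+ 3) / 2))
  D≡negOnePow = alternating-unique D (λ n → negOnePow (n + C)) D-suc negOnePow-alternating
    (- + r) (trans D-base (antidiagonalSign≡negOnePow r))
    where
    C = + ((r ℕ.+ 3) / 2)
    reassoc : ∀ n C → n + + 1 + C ≡ n + C + + 1
    reassoc = solve-∀
    negOnePow-alternating : ∀ n → negOnePow (n + + 1 + C) ≡ - negOnePow (n + C)
    negOnePow-alternating n = trans (cong negOnePow (reassoc n C)) (negOnePow-suc (n + C))

theorem2 : (r : ℕ) → r ≥ 1 → (f : ℤ → ℤ) → IsHyperfibZ r f →
    (n : ℤ) → det (r Data.Nat.+ 2) (hankel r f n) ≡ negOnePow (n + + ((r Data.Nat.+ 3) / 2))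
theorem2 (suc t) _ f hyp n = begin
  det (suc t ℕ.+ 2) (hankel (suc t) f n)  ≡⟨ det≡detℕ _ (hankel (suc t) f n) (hankelℕ f n) (λ _ _ → refl) ⟩
  detℕ (suc t ℕ.+ 2) (hankelℕ f n)        ≡⟨ cong (λ k → detℕ k (hankelℕ f n)) (ℕ.+-comm (suc t) 2) ⟩
  D n                                     ≡⟨ D≡negOnePow n ⟩
  negOnePow (n + + ((suc t ℕ.+ 3) / 2))   ∎
  where
  open HyperfibonacciHankel t f hyp
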